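{- Let $T$ be a tournament and let $X, M\subseteq V(T)$ be such that $X$ dominates $T$ (i.e. $(x,y)\in A(T)$ for every $x\in X$ and $y\in V(T)\setminus X$). Then $T$ is $M$-sparse if and only if $T[X]$ is $(M\cap X)$-sparse and $T-X$ is $(M\setminus X)$-sparse.
   Context: A tournament is a digraph with exactly one arc between each pair of distinct vertices; $T[Y]$ is the subtournament induced by $Y$ and $T-Y=T[V(T)\setminus Y]$. Given an ordering of the vertices, an arc is backward if its head precedes its tail. For a tournament $S$ and $N\subseteq V(S)$, $S$ is $N$-sparse if there is an ordering $\sigma$ of $V(S)$ in which every vertex is incident to at most one backward arc of $S$ and every vertex of $N$ is incident to no backward arc; such $\sigma$ is an $N$-sparse ordering. -}

module Defs where

open import Data.Nat using (ℕ; _<_)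
open import Data.Fin using (Fin)
open import Data.Fin.Subset using (Subset; _∈_; _∉_)
open import Data.Bool using (Bool; true; false; not)
open import Data.Product using (_×_; _,_; Σ)
open import Data.Sum using (_⊎_)
open import Relation.Binary.PropositionalEquality using (_≡_; _≢_)
open import Relation.Nullary using (¬_)

-- A digraph on vertex set Fin n, given by its arc relation:
-- arc u v ≡ true  iff  (u , v) is an arc (tail u, head v).
Digraph : ℕ → Set
Digraph n = Fin n → Fin n → Bool

record IsTournament {n : ℕ} (T : Digraph n) : Set where
  field
    irrefl : ∀ u → T u u ≡ false
    tour   : ∀ u v → u ≢ v → T u v ≡ not (T v u)

-- An ordering of a vertex set Y ⊆ Fin n, represented by the position of
-- each vertex; positions of distinct vertices of Y are distinct.
record Ordering {n : ℕ} (Y : Subset n) : Set where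
  field
    pos : Fin n → ℕ
    pos-inj : ∀ u v → u ∈ Y → v ∈ Y → pos u ≡ pos v → u ≡ v
open Ordering public

Backward : {n : ℕ} (T : Digraph n) (Y : Subset n) (σ : Ordering Y)
           → Fin n → Fin n → Set
Backward T Y σ u v = u ∈ Y × v ∈ Y × T u v ≡ true × pos σ v < pos σ u

Incident : {n : ℕ} → Fin n → Fin n → Fin n → Set
Incident w u v = (w ≡ u) ⊎ (w ≡ v)

IsSparseOrdering : {n : ℕ} (T : Digraph n) (Y N : Subset n) → Ordering Y → Set
IsSparseOrdering T Y N σ =
  (∀ w → w ∈ Y → ∀ u v u' v' →
     Backward T Y σ u v → Incident w u v →
     Backward T Y σ u' v' → Incident w u' v' →
     (u ≡ u') × (v ≡ v'))
  × (∀ w → w ∈ N → ∀ u v → Backward T Y σ u v → ¬ Incident w u v)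

Sparse : {n : ℕ} (T : Digraph n) (Y N : Subset n) → Set
Sparse T Y N = Σ (Ordering Y) (IsSparseOrdering T Y N)

Dominates : {n : ℕ} (T : Digraph n) (X : Subset n) → Set
Dominates T X = ∀ x y → x ∈ X → y ∉ X → T x y ≡ true

{-# OPTIONS --safe #-}
module Submission where

-- Restricting an M-sparse ordering of T to X and to V(T) ∖ X gives sparse
-- orderings of both parts, whatever X is. Conversely, list X first and then
-- V(T) ∖ X: since X dominates T, no arc goes from V(T) ∖ X into X, so every
-- backward arc of the concatenated ordering lies inside one of the two parts,
-- and sparseness of the parts transfers to the whole.

open import Defs
open import Data.Nat using (ℕ; suc; _+_; _<_; s≤s)
open import Data.Nat.Properties
  using (<-irrefl; <-asym; <-≤-trans; m≤m+n; +-cancelˡ-≡; +-cancelˡ-<)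
open import Data.Fin using (Fin)
open import Data.Fin.Subset using (Subset; ⊤; _∩_; ∁; _∈_; _∉_; _⊆_)
open import Data.Fin.Subset.Properties
  using (_∈?_; ⊆⊤; x∈∁p⇒x∉p; x∉p⇒x∈∁p; x∈p∩q⁺; x∈p∩q⁻)
open import Data.List using (tabulate)
open import Data.List.Extrema.Nat using (max; xs≤max)
open import Data.List.Membership.Propositional.Properties using (∈-tabulate⁺)
import Data.List.Relation.Unary.All as All
open import Data.Bool using (false; not)
open import Data.Product using (_×_; _,_; proj₁)
open import Data.Sum using (_⊎_; inj₁; inj₂)
open import Data.Empty using (⊥-elim)
open import Function.Bundles using (_⇔_; mk⇔)
open import Relation.Nullary using (yes; no; ¬_)
open import Relation.Binary.PropositionalEquality

private variable
  n : ℕ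
  T : Digraph n
  X Y Z M N : Subset n
  u v w : Fin n

backward-incident-∈ : (T : Digraph n) (σ : Ordering Y) →
                      Backward T Y σ u v → Incident w u v → w ∈ Y
backward-incident-∈ T σ (u∈Y , _ , _) (inj₁ refl) = u∈Y
backward-incident-∈ T σ (_ , v∈Y , _) (inj₂ refl) = v∈Y

restrict : Y ⊆ Z → Ordering Z → Ordering Y
restrict Y⊆Z σ = record
  { pos = pos σ
  ; pos-inj = λ u v u∈Y v∈Y → pos-inj σ u v (Y⊆Z u∈Y) (Y⊆Z v∈Y)
  }

backward-restrict : (Y⊆Z : Y ⊆ Z) (σ : Ordering Z) →
                    Backward T Y (restrict Y⊆Z σ) u v → Backward T Z σ u v
backward-restrict Y⊆Z σ (u∈Y , v∈Y , arc , v<u) = Y⊆Z u∈Y , Y⊆Z v∈Y , arc , v<u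

sparse-restrict : Y ⊆ Z → Sparse T Z N → Sparse T Y (N ∩ Y)
sparse-restrict {Y = Y} {T = T} {N = N} Y⊆Z (σ , atMostOne , noneAtN) =
  restrict Y⊆Z σ
  , (λ w w∈Y u v u′ v′ b i b′ i′ →
       atMostOne w (Y⊆Z w∈Y) u v u′ v′ (↑ b) i (↑ b′) i′)
  , (λ w w∈N∩Y u v b → noneAtN w (proj₁ (x∈p∩q⁻ N Y w∈N∩Y)) u v (↑ b))
  where
  ↑ : Backward T Y (restrict Y⊆Z σ) u v → Backward T _ σ u v
  ↑ = backward-restrict {T = T} Y⊆Z σ

strictUpperBound : (Fin n → ℕ) → ℕ
strictUpperBound f = suc (max 0 (tabulate f))

<-strictUpperBound : (f : Fin n → ℕ) (u : Fin n) → f u < strictUpperBound f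
<-strictUpperBound f u = s≤s (All.lookup (xs≤max 0 (tabulate f)) (∈-tabulate⁺ u))

module _ {X : Subset n} (σ₁ : Ordering X) (σ₂ : Ordering (∁ X)) where

  offset : ℕ
  offset = strictUpperBound (pos σ₁)

  concatPos : Fin n → ℕ
  concatPos u with u ∈? X
  ... | yes _ = pos σ₁ u
  ... | no _  = offset + pos σ₂ u

  pos₁<offset+pos₂ : ∀ u v → pos σ₁ u < offset + pos σ₂ v
  pos₁<offset+pos₂ u v = <-≤-trans (<-strictUpperBound (pos σ₁) u) (m≤m+n offset (pos σ₂ v))

  concatPos-inj : ∀ u v → u ∈ ⊤ → v ∈ ⊤ → concatPos u ≡ concatPos v → u ≡ v
  concatPos-inj u v _ _ eq with u ∈? X | v ∈? X
  ... | yes u∈X | yes v∈X = pos-inj σ₁ u v u∈X v∈X eq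
  ... | no u∉X  | no v∉X  = pos-inj σ₂ u v (x∉p⇒x∈∁p u∉X) (x∉p⇒x∈∁p v∉X) (+-cancelˡ-≡ offset _ _ eq)
  ... | yes _   | no _    = ⊥-elim (<-irrefl eq (pos₁<offset+pos₂ u v))
  ... | no _    | yes _   = ⊥-elim (<-irrefl (sym eq) (pos₁<offset+pos₂ v u))

  concat : Ordering ⊤
  concat = record { pos = concatPos ; pos-inj = concatPos-inj }

no-arc-into-dominating : IsTournament T → Dominates T X → v ∈ X → u ∉ X → T u v ≡ false
no-arc-into-dominating {T = T} {v = v} {u = u} isT dom v∈X u∉X = begin
  T u v        ≡⟨ IsTournament.tour isT u v u≢v ⟩
  not (T v u)  ≡⟨ cong not (dom v u v∈X u∉X) ⟩
  false        ∎
  where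
  open ≡-Reasoning
  u≢v : u ≢ v
  u≢v refl = u∉X v∈X

backward-concat : IsTournament T → Dominates T X →
                  (σ₁ : Ordering X) (σ₂ : Ordering (∁ X)) →
                  Backward T ⊤ (concat σ₁ σ₂) u v →
                  Backward T X σ₁ u v ⊎ Backward T (∁ X) σ₂ u v
backward-concat {X = X} {u = u} {v = v} isT dom σ₁ σ₂ (_ , _ , arc , v<u)
  with u ∈? X | v ∈? X
... | yes u∈X | yes v∈X =
  inj₁ (u∈X , v∈X , arc , v<u)
... | no u∉X | no v∉X =
  inj₂ (x∉p⇒x∈∁p u∉X , x∉p⇒x∈∁p v∉X , arc , +-cancelˡ-< _ _ _ v<u)
... | yes _ | no _ = ⊥-elim (<-asym v<u (pos₁<offset+pos₂ σ₁ σ₂ u v))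
... | no u∉X | yes v∈X with () ← trans (sym arc) (no-arc-into-dominating isT dom v∈X u∉X)

isSparse-concat : IsTournament T → Dominates T X →
                  (σ₁ : Ordering X) (σ₂ : Ordering (∁ X)) →
                  IsSparseOrdering T X (M ∩ X) σ₁ →
                  IsSparseOrdering T (∁ X) (M ∩ ∁ X) σ₂ →
                  IsSparseOrdering T ⊤ M (concat σ₁ σ₂)
isSparse-concat {T = T} {X = X} {M = M} isT dom σ₁ σ₂
                (atMostOne₁ , noneAtM₁) (atMostOne₂ , noneAtM₂) = atMostOne , noneAtM
  where
  split : Backward T ⊤ (concat σ₁ σ₂) u v → Backward T X σ₁ u v ⊎ Backward T (∁ X) σ₂ u v
  split = backward-concat isT dom σ₁ σ₂

  ∈X : Backward T X σ₁ u v → Incident w u v → w ∈ X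
  ∈X = backward-incident-∈ T σ₁

  ∈∁X : Backward T (∁ X) σ₂ u v → Incident w u v → w ∈ ∁ X
  ∈∁X = backward-incident-∈ T σ₂

  atMostOne : ∀ w → w ∈ ⊤ → ∀ u v u′ v′ →
              Backward T ⊤ (concat σ₁ σ₂) u v → Incident w u v →
              Backward T ⊤ (concat σ₁ σ₂) u′ v′ → Incident w u′ v′ →
              (u ≡ u′) × (v ≡ v′)
  atMostOne w _ u v u′ v′ b i b′ i′ with split b | split b′
  ... | inj₁ c | inj₁ c′ = atMostOne₁ w (∈X c i) u v u′ v′ c i c′ i′
  ... | inj₂ c | inj₂ c′ = atMostOne₂ w (∈∁X c i) u v u′ v′ c i c′ i′
  ... | inj₁ c | inj₂ c′ = ⊥-elim (x∈∁p⇒x∉p (∈∁X c′ i′) (∈X c i))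
  ... | inj₂ c | inj₁ c′ = ⊥-elim (x∈∁p⇒x∉p (∈∁X c i) (∈X c′ i′))

  noneAtM : ∀ w → w ∈ M → ∀ u v → Backward T ⊤ (concat σ₁ σ₂) u v → ¬ Incident w u v
  noneAtM w w∈M u v b i with split b
  ... | inj₁ c = noneAtM₁ w (x∈p∩q⁺ (w∈M , ∈X c i)) u v c i
  ... | inj₂ c = noneAtM₂ w (x∈p∩q⁺ (w∈M , ∈∁X c i)) u v c i

mainTheorem15 : (n : ℕ) (T : Digraph n) → IsTournament T →
    (X M : Subset n) → Dominates T X →
    Sparse T ⊤ M ⇔ (Sparse T X (M ∩ X) × Sparse T (∁ X) (M ∩ ∁ X))
mainTheorem15 n T isT X M dom = mk⇔
  (λ s → sparse-restrict ⊆⊤ s , sparse-restrict ⊆⊤ s)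
  (λ ((σ₁ , s₁) , (σ₂ , s₂)) → concat σ₁ σ₂ , isSparse-concat isT dom σ₁ σ₂ s₁ s₂)
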